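{- Let $d\ge0$ be an integer and $S\subseteq[n]$. Let $Z_{d(S)}$ be the $\mathcal{P}_d(n)\times\mathcal{P}_d(n)$ matrix with $[Z_{d(S)}]_{I,J}=1$ if $I\subseteq J\oplus S$ and $0$ otherwise, let $Z_d=Z_{d(\emptyset)}$, and let $A_{d(S)}$ be the $\mathcal{P}_d(n)\times\mathcal{P}_d(n)$ matrix with $[A_{d(S)}]_{I,K}=(-1)^{|K\cap S|}$ if $(I\setminus S)\subseteq K\subseteq I$ and $0$ otherwise. Then $Z_{d(S)}$ is invertible and $Z_{d(S)}^{ -1}=Z_d^{ -1}A_{d(S)}$.
   Context: $\mathcal{P}_d(n)$ is the family of subsets of $[n]$ of size at most $d$; $\oplus$ denotes symmetric difference of sets. -}

module Defs where

open import Data.Nat using (ℕ; zero; suc; _≤_; _≤?_)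
open import Data.Bool using (Bool; true; false; _xor_)
open import Data.Integer using (ℤ; 0ℤ; 1ℤ; -1ℤ; _+_; _*_)
open import Data.Integer.Properties using ()
open import Data.List using (List; []; _∷_; map; _++_; filter; foldr)
open import Data.List.Membership.Propositional using (_∈_)
open import Data.Vec using (Vec; []; _∷_; zipWith)
open import Data.Fin.Subset using (Subset; _⊆_; _∩_; _─_; ∣_∣; outside; inside)
open import Data.Fin.Subset.Properties using (_⊆?_)
open import Data.Product using (_×_)
open import Relation.Nullary using (yes; no)
open import Relation.Binary.PropositionalEquality using (_≡_)
open import Data.Vec.Properties using (≡-dec)
open import Data.Bool.Properties using () renaming (_≟_ to _≟B_)

allSubsets : (n : ℕ) → List (Subset n)
allSubsets zero = [] ∷ []
allSubsets (suc n) = map (outside ∷_) (allSubsets n) ++ map (inside ∷_) (allSubsets n)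

P : (d n : ℕ) → List (Subset n)
P d n = filter (λ I → ∣ I ∣ ≤? d) (allSubsets n)

_⊕_ : ∀ {n} → Subset n → Subset n → Subset n
_⊕_ = zipWith _xor_

∅ : ∀ {n} → Subset n
∅ {zero} = []
∅ {suc n} = outside ∷ ∅

-- matrices indexed by subsets of [n]; only entries on 𝒫_d(n) × 𝒫_d(n) matter
Mat : ℕ → Set
Mat n = Subset n → Subset n → ℤ

mul : (d : ℕ) {n : ℕ} → Mat n → Mat n → Mat n
mul d {n} M N I K = foldr (λ J acc → M I J * N J K + acc) 0ℤ (P d n)

Id : ∀ {n} → Mat n
Id I K with ≡-dec _≟B_ I K
... | yes _ = 1ℤ
... | no _ = 0ℤ

_≈[_]_ : ∀ {n} → Mat n → ℕ → Mat n → Set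
_≈[_]_ {n} M d N = ∀ I K → I ∈ P d n → K ∈ P d n → M I K ≡ N I K

IsInverse : (d : ℕ) {n : ℕ} → Mat n → Mat n → Set
IsInverse d W M = (mul d W M ≈[ d ] Id) × (mul d M W ≈[ d ] Id)

sgn : ℕ → ℤ
sgn zero = 1ℤ
sgn (suc k) = -1ℤ * sgn k

Z : ∀ {n} → Subset n → Mat n
Z S I J with I ⊆? (J ⊕ S)
... | yes _ = 1ℤ
... | no _ = 0ℤ

A : ∀ {n} → Subset n → Mat n
A S I K with (I ─ S) ⊆? K | K ⊆? I
... | yes _ | yes _ = sgn ∣ K ∩ S ∣
... | _     | _     = 0ℤ

-- Every matrix involved is a Kronecker product over the n coordinates of 2×2 matrices, the
-- factor at coordinate i depending only on whether i ∈ S.  Over the full Boolean lattice,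
-- products of such matrices are therefore computed coordinatewise, and each claimed
-- identity reduces to a finite check on 2×2 matrices: with Z = Z_∅ and W the Möbius matrix
-- (-1)^{|I|+|J|} [I ⊆ J], one has W Z = 1, Z W = 1, A Z_S = Z, Z_S W = A and A A = 1.
-- Restricting the index set to 𝒫_d(n) changes none of these products, because in each of
-- them one factor is supported on pairs (I, J) with I ⊆ J or J ⊆ I, which kills every
-- middle index J with |J| > d.
module Submission where

open import Defs
open import Data.Nat using (ℕ; zero; suc; _≤_; _<_; _≤?_; s≤s)
open import Data.Nat.Properties using (≰⇒>; ≤-<-trans; <-trans; n<1+n)
open import Data.Bool using (Bool; true; false; not; _∨_; _∧_; _xor_)
open import Data.Integer using (ℤ; 0ℤ; 1ℤ; -1ℤ; _+_; _*_)
open import Data.Integer.Properties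
  using (+-identityˡ; *-identityˡ; *-zeroˡ; *-zeroʳ; *-distribʳ-+; *-distribˡ-+; *-assoc; +-assoc;
         +-commutativeSemigroup; *-commutativeSemigroup)
open import Data.List using (List; []; _∷_; map; _++_; filter; foldr)
open import Data.List.Membership.Propositional using (_∈_)
open import Data.List.Membership.Propositional.Properties using (∈-filter⁻)
open import Data.List.Relation.Unary.Any using (here; there)
open import Data.Fin.Subset using (Subset; _∩_; _─_; ∣_∣; outside; inside)
open import Data.Fin.Subset.Properties using (_⊆?_)
open import Data.Vec using ([]; _∷_)
open import Data.Vec.Properties using (≡-dec)
open import Data.Bool.Properties using () renaming (_≟_ to _≟B_)
open import Data.Product using (Σ; _×_; _,_; proj₂)
open import Data.Sum as Sum using (_⊎_; inj₁; inj₂)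
open import Data.Empty using (⊥-elim)
open import Relation.Nullary using (yes; no; does; ¬_; Dec)
open import Relation.Binary.PropositionalEquality
import Algebra.Properties.CommutativeSemigroup as CommSemigroupProperties

+-interchange : ∀ a b c d → (a + b) + (c + d) ≡ (a + c) + (b + d)
+-interchange = CommSemigroupProperties.interchange +-commutativeSemigroup

*-interchange : ∀ a b c d → (a * b) * (c * d) ≡ (a * c) * (b * d)
*-interchange = CommSemigroupProperties.interchange *-commutativeSemigroup

∑ : {A : Set} → List A → (A → ℤ) → ℤ
∑ xs g = foldr (λ x acc → g x + acc) 0ℤ xs

∑-cong-∈ : {A : Set} {f g : A → ℤ} (xs : List A) → (∀ x → x ∈ xs → f x ≡ g x) → ∑ xs f ≡ ∑ xs g
∑-cong-∈ []       h = refl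
∑-cong-∈ (x ∷ xs) h = cong₂ _+_ (h x (here refl)) (∑-cong-∈ xs (λ y y∈xs → h y (there y∈xs)))

∑-cong : {A : Set} {f g : A → ℤ} (xs : List A) → (∀ x → f x ≡ g x) → ∑ xs f ≡ ∑ xs g
∑-cong xs h = ∑-cong-∈ xs (λ x _ → h x)

∑-++ : {A : Set} (xs ys : List A) (f : A → ℤ) → ∑ (xs ++ ys) f ≡ ∑ xs f + ∑ ys f
∑-++ []       ys f = sym (+-identityˡ _)
∑-++ (x ∷ xs) ys f = trans (cong (f x +_) (∑-++ xs ys f)) (sym (+-assoc (f x) (∑ xs f) (∑ ys f)))

∑-map : {A B : Set} (h : A → B) (xs : List A) (f : B → ℤ) → ∑ (map h xs) f ≡ ∑ xs (λ x → f (h x))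
∑-map h []       f = refl
∑-map h (x ∷ xs) f = cong (f (h x) +_) (∑-map h xs f)

∑-zero : {A : Set} (xs : List A) → ∑ xs (λ _ → 0ℤ) ≡ 0ℤ
∑-zero []       = refl
∑-zero (x ∷ xs) = trans (+-identityˡ _) (∑-zero xs)

∑-+ : {A : Set} (xs : List A) (f g : A → ℤ) → ∑ xs (λ x → f x + g x) ≡ ∑ xs f + ∑ xs g
∑-+ []       f g = refl
∑-+ (x ∷ xs) f g =
  trans (cong ((f x + g x) +_) (∑-+ xs f g)) (+-interchange (f x) (g x) (∑ xs f) (∑ xs g))

∑-*ˡ : {A : Set} (c : ℤ) (xs : List A) (f : A → ℤ) → ∑ xs (λ x → c * f x) ≡ c * ∑ xs f
∑-*ˡ c []       f = sym (*-zeroʳ c)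
∑-*ˡ c (x ∷ xs) f = trans (cong (c * f x +_) (∑-*ˡ c xs f)) (sym (*-distribˡ-+ c (f x) (∑ xs f)))

∑-*ʳ : {A : Set} (c : ℤ) (xs : List A) (f : A → ℤ) → ∑ xs f * c ≡ ∑ xs (λ x → f x * c)
∑-*ʳ c []       f = refl
∑-*ʳ c (x ∷ xs) f = trans (*-distribʳ-+ c (f x) (∑ xs f)) (cong (f x * c +_) (∑-*ʳ c xs f))

∑-comm : {A B : Set} (xs : List A) (ys : List B) (f : A → B → ℤ) →
  ∑ ys (λ y → ∑ xs (λ x → f x y)) ≡ ∑ xs (λ x → ∑ ys (f x))
∑-comm xs []       f = sym (∑-zero xs)
∑-comm xs (y ∷ ys) f =
  trans (cong (∑ xs (λ x → f x y) +_) (∑-comm xs ys f)) (sym (∑-+ xs (λ x → f x y) (λ x → ∑ ys (f x))))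

∑-filter : {A : Set} {Q : A → Set} (Q? : (x : A) → Dec (Q x)) (xs : List A) (g : A → ℤ) →
  (∀ x → ¬ Q x → g x ≡ 0ℤ) → ∑ (filter Q? xs) g ≡ ∑ xs g
∑-filter Q? []       g g≡0 = refl
∑-filter Q? (x ∷ xs) g g≡0 with Q? x
... | yes _  = cong (g x +_) (∑-filter Q? xs g g≡0)
... | no ¬Qx = trans (∑-filter Q? xs g g≡0) (sym (trans (cong (_+ ∑ xs g) (g≡0 x ¬Qx)) (+-identityˡ _)))

∑-all : (n : ℕ) → (Subset n → ℤ) → ℤ
∑-all n = ∑ (allSubsets n)

∑-all-suc : (n : ℕ) (g : Subset (suc n) → ℤ) →
  ∑-all (suc n) g ≡ ∑-all n (λ J → g (outside ∷ J)) + ∑-all n (λ J → g (inside ∷ J))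
∑-all-suc n g = trans (∑-++ (map (outside ∷_) (allSubsets n)) (map (inside ∷_) (allSubsets n)) g)
  (cong₂ _+_ (∑-map (outside ∷_) (allSubsets n) g) (∑-map (inside ∷_) (allSubsets n) g))

∈P⇒∣∣≤ : ∀ {d n I} → I ∈ P d n → ∣ I ∣ ≤ d
∈P⇒∣∣≤ {d} {n} I∈P = proj₂ (∈-filter⁻ (λ I → ∣ I ∣ ≤? d) {xs = allSubsets n} I∈P)

∑-P : (d n : ℕ) (g : Subset n → ℤ) → (∀ J → d < ∣ J ∣ → g J ≡ 0ℤ) → ∑ (P d n) g ≡ ∑-all n g
∑-P d n g g≡0 = ∑-filter (λ I → ∣ I ∣ ≤? d) (allSubsets n) g (λ J ∣J∣≰d → g≡0 J (≰⇒> ∣J∣≰d))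

mul-cong : ∀ d {n} {M M′ N N′ : Mat n} → (∀ I J → M I J ≡ M′ I J) → (∀ I J → N I J ≡ N′ I J) →
  ∀ I K → mul d M N I K ≡ mul d M′ N′ I K
mul-cong d {n} M≡M′ N≡N′ I K = ∑-cong (P d n) (λ J → cong₂ _*_ (M≡M′ I J) (N≡N′ J K))

mul-assoc : ∀ d {n} (M N L : Mat n) I K → mul d (mul d M N) L I K ≡ mul d M (mul d N L) I K
mul-assoc d {n} M N L I K = begin
  ∑ 𝒫 (λ J → ∑ 𝒫 (λ J′ → M I J′ * N J′ J) * L J K)
    ≡⟨ ∑-cong 𝒫 (λ J → ∑-*ʳ (L J K) 𝒫 (λ J′ → M I J′ * N J′ J)) ⟩
  ∑ 𝒫 (λ J → ∑ 𝒫 (λ J′ → (M I J′ * N J′ J) * L J K))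
    ≡⟨ ∑-comm 𝒫 𝒫 (λ J′ J → (M I J′ * N J′ J) * L J K) ⟩
  ∑ 𝒫 (λ J′ → ∑ 𝒫 (λ J → (M I J′ * N J′ J) * L J K))
    ≡⟨ ∑-cong 𝒫 (λ J′ → ∑-cong 𝒫 (λ J → *-assoc (M I J′) (N J′ J) (L J K))) ⟩
  ∑ 𝒫 (λ J′ → ∑ 𝒫 (λ J → M I J′ * (N J′ J * L J K)))
    ≡⟨ ∑-cong 𝒫 (λ J′ → ∑-*ˡ (M I J′) 𝒫 (λ J → N J′ J * L J K)) ⟩
  ∑ 𝒫 (λ J′ → M I J′ * ∑ 𝒫 (λ J → N J′ J * L J K))
    ∎
  where
  open ≡-Reasoning
  𝒫 = P d n

-- k s x y is the (x, y) entry of the 2×2 factor at a coordinate whose membership in S is s.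
Kernel : Set
Kernel = Bool → Bool → Bool → ℤ

tensor : ∀ {n} → Kernel → Subset n → Mat n
tensor k []      []      []      = 1ℤ
tensor k (s ∷ S) (x ∷ I) (y ∷ J) = k s x y * tensor k S I J

_⊙_ : Kernel → Kernel → Kernel
(k ⊙ k′) s x y = k s x y * k′ s x y

transpose : Kernel → Kernel
transpose k s x y = k s y x

Composes : Kernel → Kernel → Kernel → Set
Composes k₁ k₂ k₃ = ∀ s x z → k₁ s x false * k₂ s false z + k₁ s x true * k₂ s true z ≡ k₃ s x z

∀-Bool³ : {P : Bool → Bool → Bool → Set} →
  P false false false → P false false true → P false true false → P false true true →
  P true false false → P true false true → P true true false → P true true true →
  ∀ s x z → P s x z
∀-Bool³ p₀ p₁ p₂ p₃ p₄ p₅ p₆ p₇ false false false = p₀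
∀-Bool³ p₀ p₁ p₂ p₃ p₄ p₅ p₆ p₇ false false true  = p₁
∀-Bool³ p₀ p₁ p₂ p₃ p₄ p₅ p₆ p₇ false true  false = p₂
∀-Bool³ p₀ p₁ p₂ p₃ p₄ p₅ p₆ p₇ false true  true  = p₃
∀-Bool³ p₀ p₁ p₂ p₃ p₄ p₅ p₆ p₇ true  false false = p₄
∀-Bool³ p₀ p₁ p₂ p₃ p₄ p₅ p₆ p₇ true  false true  = p₅
∀-Bool³ p₀ p₁ p₂ p₃ p₄ p₅ p₆ p₇ true  true  false = p₆
∀-Bool³ p₀ p₁ p₂ p₃ p₄ p₅ p₆ p₇ true  true  true  = p₇

UpperTriangular : Kernel → Set
UpperTriangular k = ∀ s → k s true false ≡ 0ℤ

LowerTriangular : Kernel → Set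
LowerTriangular k = UpperTriangular (transpose k)

tensor-⊙ : (k k′ : Kernel) → ∀ {n} (S I K : Subset n) →
  tensor (k ⊙ k′) S I K ≡ tensor k S I K * tensor k′ S I K
tensor-⊙ k k′ []      []      []      = refl
tensor-⊙ k k′ (s ∷ S) (x ∷ I) (y ∷ K) =
  trans (cong (k s x y * k′ s x y *_) (tensor-⊙ k k′ S I K)) (*-interchange (k s x y) (k′ s x y) _ _)

tensor-transpose : (k : Kernel) → ∀ {n} (S I J : Subset n) →
  tensor (transpose k) S I J ≡ tensor k S J I
tensor-transpose k []      []      []      = refl
tensor-transpose k (s ∷ S) (x ∷ I) (y ∷ J) = cong (k s y x *_) (tensor-transpose k S I J)

tensor-∅ : (k k′ : Kernel) → (∀ s x y → k outside x y ≡ k′ s x y) →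
  ∀ {n} (S I J : Subset n) → tensor k ∅ I J ≡ tensor k′ S I J
tensor-∅ k k′ k≡k′ []      []      []      = refl
tensor-∅ k k′ k≡k′ (s ∷ S) (x ∷ I) (y ∷ J) = cong₂ _*_ (k≡k′ s x y) (tensor-∅ k k′ k≡k′ S I J)

∑-all-tensor : {k₁ k₂ k₃ : Kernel} → Composes k₁ k₂ k₃ → ∀ n (S I K : Subset n) →
  ∑-all n (λ J → tensor k₁ S I J * tensor k₂ S J K) ≡ tensor k₃ S I K
∑-all-tensor k₁k₂≡k₃ zero []      []      []      = refl
∑-all-tensor {k₁} {k₂} {k₃} k₁k₂≡k₃ (suc n) (s ∷ S) (x ∷ I) (z ∷ K) = begin
  ∑-all (suc n) (λ J → tensor k₁ (s ∷ S) (x ∷ I) J * tensor k₂ (s ∷ S) J (z ∷ K))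
    ≡⟨ ∑-all-suc n (λ J → tensor k₁ (s ∷ S) (x ∷ I) J * tensor k₂ (s ∷ S) J (z ∷ K)) ⟩
  ∑-all n (λ J → (k₁ s x false * tensor k₁ S I J) * (k₂ s false z * tensor k₂ S J K)) +
  ∑-all n (λ J → (k₁ s x true * tensor k₁ S I J) * (k₂ s true z * tensor k₂ S J K))
    ≡⟨ cong₂ _+_ (factor false) (factor true) ⟩
  k₁ s x false * k₂ s false z * rest + k₁ s x true * k₂ s true z * rest
    ≡⟨ sym (*-distribʳ-+ rest (k₁ s x false * k₂ s false z) (k₁ s x true * k₂ s true z)) ⟩
  (k₁ s x false * k₂ s false z + k₁ s x true * k₂ s true z) * rest
    ≡⟨ cong₂ _*_ (k₁k₂≡k₃ s x z) (∑-all-tensor k₁k₂≡k₃ n S I K) ⟩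
  tensor k₃ (s ∷ S) (x ∷ I) (z ∷ K) ∎
  where
  open ≡-Reasoning
  rest = ∑-all n (λ J → tensor k₁ S I J * tensor k₂ S J K)
  factor : ∀ y → ∑-all n (λ J → (k₁ s x y * tensor k₁ S I J) * (k₂ s y z * tensor k₂ S J K))
                 ≡ k₁ s x y * k₂ s y z * rest
  factor y =
    trans (∑-cong (allSubsets n) (λ J → *-interchange (k₁ s x y) (tensor k₁ S I J) (k₂ s y z) (tensor k₂ S J K)))
          (∑-*ˡ (k₁ s x y * k₂ s y z) (allSubsets n) (λ J → tensor k₁ S I J * tensor k₂ S J K))

tensor-∷-zero : (k : Kernel) → ∀ {n} s x y (S I J : Subset n) →
  tensor k S I J ≡ 0ℤ → tensor k (s ∷ S) (x ∷ I) (y ∷ J) ≡ 0ℤ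
tensor-∷-zero k s x y S I J ≡0 = trans (cong (k s x y *_) ≡0) (*-zeroʳ (k s x y))

tensor-upper : (k : Kernel) → UpperTriangular k →
  ∀ {n} (S I J : Subset n) → ∣ J ∣ < ∣ I ∣ → tensor k S I J ≡ 0ℤ
tensor-upper k up (s ∷ S) (true ∷ I) (false ∷ J) _ =
  trans (cong (_* tensor k S I J) (up s)) (*-zeroˡ (tensor k S I J))
tensor-upper k up (s ∷ S) (true ∷ I) (true ∷ J) (s≤s ∣J∣<∣I∣) =
  tensor-∷-zero k s true true S I J (tensor-upper k up S I J ∣J∣<∣I∣)
tensor-upper k up (s ∷ S) (false ∷ I) (false ∷ J) ∣J∣<∣I∣ =
  tensor-∷-zero k s false false S I J (tensor-upper k up S I J ∣J∣<∣I∣)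
tensor-upper k up (s ∷ S) (false ∷ I) (true ∷ J) ∣J∣<∣I∣ =
  tensor-∷-zero k s false true S I J (tensor-upper k up S I J (<-trans (n<1+n ∣ J ∣) ∣J∣<∣I∣))

tensor-lower : (k : Kernel) → LowerTriangular k →
  ∀ {n} (S I J : Subset n) → ∣ I ∣ < ∣ J ∣ → tensor k S I J ≡ 0ℤ
tensor-lower k low S I J ∣I∣<∣J∣ =
  trans (sym (tensor-transpose k S J I)) (tensor-upper (transpose k) low S J I ∣I∣<∣J∣)

mul-tensor-upperʳ : {k₁ k₂ k₃ : Kernel} → UpperTriangular k₂ → Composes k₁ k₂ k₃ →
  ∀ d {n} (S I K : Subset n) → K ∈ P d n → mul d (tensor k₁ S) (tensor k₂ S) I K ≡ tensor k₃ S I K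
mul-tensor-upperʳ {k₁} {k₂} up k₁k₂≡k₃ d {n} S I K K∈P =
  trans (∑-P d n _ vanish) (∑-all-tensor k₁k₂≡k₃ n S I K)
  where
  vanish : ∀ J → d < ∣ J ∣ → tensor k₁ S I J * tensor k₂ S J K ≡ 0ℤ
  vanish J d<∣J∣ =
    trans (cong (tensor k₁ S I J *_) (tensor-upper k₂ up S J K (≤-<-trans (∈P⇒∣∣≤ K∈P) d<∣J∣)))
          (*-zeroʳ (tensor k₁ S I J))

mul-tensor-lowerˡ : {k₁ k₂ k₃ : Kernel} → LowerTriangular k₁ → Composes k₁ k₂ k₃ →
  ∀ d {n} (S I K : Subset n) → I ∈ P d n → mul d (tensor k₁ S) (tensor k₂ S) I K ≡ tensor k₃ S I K
mul-tensor-lowerˡ {k₁} {k₂} low k₁k₂≡k₃ d {n} S I K I∈P =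
  trans (∑-P d n _ vanish) (∑-all-tensor k₁k₂≡k₃ n S I K)
  where
  vanish : ∀ J → d < ∣ J ∣ → tensor k₁ S I J * tensor k₂ S J K ≡ 0ℤ
  vanish J d<∣J∣ =
    trans (cong (_* tensor k₂ S J K) (tensor-lower k₁ low S I J (≤-<-trans (∈P⇒∣∣≤ I∈P) d<∣J∣)))
          (*-zeroˡ (tensor k₂ S J K))

χ : Bool → ℤ
χ true  = 1ℤ
χ false = 0ℤ

±1 : Bool → ℤ
±1 true  = -1ℤ
±1 false = 1ℤ

zKernel : Kernel
zKernel s x y = χ (not x ∨ (y xor s))

subsetKernel : Kernel
subsetKernel s x y = χ (not x ∨ y)

möbiusKernel : Kernel
möbiusKernel s x y = (±1 x * ±1 y) * χ (not x ∨ y)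

idKernel : Kernel
idKernel s false false = 1ℤ
idKernel s true  true  = 1ℤ
idKernel s false true  = 0ℤ
idKernel s true  false = 0ℤ

diffSubsetKernel : Kernel
diffSubsetKernel s x y = χ (not (x ∧ not s) ∨ y)

signKernel : Kernel
signKernel s x y = ±1 (y ∧ s)

aKernel : Kernel
aKernel = (diffSubsetKernel ⊙ transpose subsetKernel) ⊙ signKernel

möbius·subset≡id : Composes möbiusKernel subsetKernel idKernel
möbius·subset≡id = ∀-Bool³ refl refl refl refl refl refl refl refl

subset·möbius≡id : Composes subsetKernel möbiusKernel idKernel
subset·möbius≡id = ∀-Bool³ refl refl refl refl refl refl refl refl

a·z≡subset : Composes aKernel zKernel subsetKernel
a·z≡subset = ∀-Bool³ refl refl refl refl refl refl refl refl

z·möbius≡a : Composes zKernel möbiusKernel aKernel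
z·möbius≡a = ∀-Bool³ refl refl refl refl refl refl refl refl

a·a≡id : Composes aKernel aKernel idKernel
a·a≡id = ∀-Bool³ refl refl refl refl refl refl refl refl

χ-⊆-⊕ : ∀ {n} (S I J : Subset n) → χ (does (I ⊆? (J ⊕ S))) ≡ tensor zKernel S I J
χ-⊆-⊕ []          []          []          = refl
χ-⊆-⊕ (s ∷ S)     (false ∷ I) (y ∷ J)     = trans (χ-⊆-⊕ S I J) (sym (*-identityˡ _))
χ-⊆-⊕ (false ∷ S) (true ∷ I)  (false ∷ J) = refl
χ-⊆-⊕ (false ∷ S) (true ∷ I)  (true ∷ J)  = trans (χ-⊆-⊕ S I J) (sym (*-identityˡ _))
χ-⊆-⊕ (true ∷ S)  (true ∷ I)  (false ∷ J) = trans (χ-⊆-⊕ S I J) (sym (*-identityˡ _))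
χ-⊆-⊕ (true ∷ S)  (true ∷ I)  (true ∷ J)  = refl

Z-tensor : ∀ {n} (S : Subset n) I J → Z S I J ≡ tensor zKernel S I J
Z-tensor S I J with I ⊆? (J ⊕ S) | χ-⊆-⊕ S I J
... | yes _ | eq = eq
... | no _  | eq = eq

Z∅-tensor : ∀ {n} (S : Subset n) I J → Z ∅ I J ≡ tensor subsetKernel S I J
Z∅-tensor S I J = trans (Z-tensor ∅ I J) (tensor-∅ zKernel subsetKernel zKernel-outside S I J)
  where
  zKernel-outside : ∀ s x y → zKernel outside x y ≡ subsetKernel s x y
  zKernel-outside s false y     = refl
  zKernel-outside s true  false = refl
  zKernel-outside s true  true  = refl

χ-─-⊆ : ∀ {n} (S I K : Subset n) → χ (does ((I ─ S) ⊆? K)) ≡ tensor diffSubsetKernel S I K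
χ-─-⊆ []          []          []          = refl
χ-─-⊆ (true ∷ S)  (false ∷ I) (y ∷ K)     = trans (χ-─-⊆ S I K) (sym (*-identityˡ _))
χ-─-⊆ (true ∷ S)  (true ∷ I)  (y ∷ K)     = trans (χ-─-⊆ S I K) (sym (*-identityˡ _))
χ-─-⊆ (false ∷ S) (false ∷ I) (y ∷ K)     = trans (χ-─-⊆ S I K) (sym (*-identityˡ _))
χ-─-⊆ (false ∷ S) (true ∷ I)  (false ∷ K) = refl
χ-─-⊆ (false ∷ S) (true ∷ I)  (true ∷ K)  = trans (χ-─-⊆ S I K) (sym (*-identityˡ _))

χ-⊆ : ∀ {n} (S I K : Subset n) → χ (does (K ⊆? I)) ≡ tensor (transpose subsetKernel) S I K
χ-⊆ []      []          []          = refl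
χ-⊆ (s ∷ S) (x ∷ I)     (false ∷ K) = trans (χ-⊆ S I K) (sym (*-identityˡ _))
χ-⊆ (s ∷ S) (false ∷ I) (true ∷ K)  = refl
χ-⊆ (s ∷ S) (true ∷ I)  (true ∷ K)  = trans (χ-⊆ S I K) (sym (*-identityˡ _))

sgn-∩ : ∀ {n} (S I K : Subset n) → sgn ∣ K ∩ S ∣ ≡ tensor signKernel S I K
sgn-∩ []          []      []          = refl
sgn-∩ (true ∷ S)  (x ∷ I) (true ∷ K)  = cong (-1ℤ *_) (sgn-∩ S I K)
sgn-∩ (false ∷ S) (x ∷ I) (true ∷ K)  = trans (sgn-∩ S I K) (sym (*-identityˡ _))
sgn-∩ (s ∷ S)     (x ∷ I) (false ∷ K) = trans (sgn-∩ S I K) (sym (*-identityˡ _))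

A-tensor : ∀ {n} (S : Subset n) I K → A S I K ≡ tensor aKernel S I K
A-tensor S I K = begin
  A S I K                                                            ≡⟨ A-χ ⟩
  χ (does ((I ─ S) ⊆? K)) * χ (does (K ⊆? I)) * sgn ∣ K ∩ S ∣
    ≡⟨ cong₂ _*_ (cong₂ _*_ (χ-─-⊆ S I K) (χ-⊆ S I K)) (sgn-∩ S I K) ⟩
  tensor diffSubsetKernel S I K * tensor (transpose subsetKernel) S I K * tensor signKernel S I K
    ≡⟨ cong (_* tensor signKernel S I K) (sym (tensor-⊙ diffSubsetKernel _ S I K)) ⟩
  tensor (diffSubsetKernel ⊙ transpose subsetKernel) S I K * tensor signKernel S I K
    ≡⟨ sym (tensor-⊙ _ signKernel S I K) ⟩
  tensor aKernel S I K                                               ∎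
  where
  open ≡-Reasoning
  A-χ : A S I K ≡ χ (does ((I ─ S) ⊆? K)) * χ (does (K ⊆? I)) * sgn ∣ K ∩ S ∣
  A-χ with (I ─ S) ⊆? K | K ⊆? I
  ... | yes _ | yes _ = sym (*-identityˡ _)
  ... | yes _ | no _  = refl
  ... | no _  | yes _ = refl
  ... | no _  | no _  = refl

tensor-id-diagonal : ∀ {n} (S I : Subset n) → tensor idKernel S I I ≡ 1ℤ
tensor-id-diagonal []      []          = refl
tensor-id-diagonal (s ∷ S) (false ∷ I) = trans (*-identityˡ _) (tensor-id-diagonal S I)
tensor-id-diagonal (s ∷ S) (true ∷ I)  = trans (*-identityˡ _) (tensor-id-diagonal S I)

tensor-id-off-diagonal : ∀ {n} (S I K : Subset n) → tensor idKernel S I K ≡ 0ℤ ⊎ I ≡ K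
tensor-id-off-diagonal []      []          []          = inj₂ refl
tensor-id-off-diagonal (s ∷ S) (false ∷ I) (true ∷ K)  = inj₁ refl
tensor-id-off-diagonal (s ∷ S) (true ∷ I)  (false ∷ K) = inj₁ refl
tensor-id-off-diagonal (s ∷ S) (false ∷ I) (false ∷ K) =
  Sum.map (trans (*-identityˡ _)) (cong (false ∷_)) (tensor-id-off-diagonal S I K)
tensor-id-off-diagonal (s ∷ S) (true ∷ I)  (true ∷ K)  =
  Sum.map (trans (*-identityˡ _)) (cong (true ∷_)) (tensor-id-off-diagonal S I K)

Id-tensor : ∀ {n} (S : Subset n) I K → Id I K ≡ tensor idKernel S I K
Id-tensor S I K with ≡-dec _≟B_ I K | tensor-id-off-diagonal S I K
... | yes refl | _         = sym (tensor-id-diagonal S I)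
... | no _     | inj₁ ≡0   = sym ≡0
... | no I≢K   | inj₂ I≡K  = ⊥-elim (I≢K I≡K)

W : ∀ {n} → Mat n
W = tensor möbiusKernel ∅

W-tensor : ∀ {n} (S : Subset n) I J → W I J ≡ tensor möbiusKernel S I J
W-tensor = tensor-∅ möbiusKernel möbiusKernel (λ _ _ _ → refl)

lemma2 : (d n : ℕ) (S : Subset n) →
    Σ (Mat n) (λ W → IsInverse d W (Z ∅) × IsInverse d (mul d W (A S)) (Z S))
lemma2 d n S = W , (WZ∅ , Z∅W) , (WA-Z , Z-WA)
  where
  WZ∅ : mul d W (Z ∅) ≈[ d ] Id
  WZ∅ I K _ K∈P = trans (mul-cong d (W-tensor ∅) (Z∅-tensor ∅) I K)
    (trans (mul-tensor-upperʳ (λ _ → refl) möbius·subset≡id d ∅ I K K∈P) (sym (Id-tensor ∅ I K)))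
  Z∅W : mul d (Z ∅) W ≈[ d ] Id
  Z∅W I K _ K∈P = trans (mul-cong d (Z∅-tensor ∅) (W-tensor ∅) I K)
    (trans (mul-tensor-upperʳ (λ _ → refl) subset·möbius≡id d ∅ I K K∈P) (sym (Id-tensor ∅ I K)))
  AZ : ∀ J K → J ∈ P d n → mul d (A S) (Z S) J K ≡ tensor subsetKernel S J K
  AZ J K J∈P = trans (mul-cong d (A-tensor S) (Z-tensor S) J K)
    (mul-tensor-lowerˡ (λ _ → refl) a·z≡subset d S J K J∈P)
  ZW : ∀ I J → J ∈ P d n → mul d (Z S) W I J ≡ tensor aKernel S I J
  ZW I J J∈P = trans (mul-cong d (Z-tensor S) (W-tensor S) I J)
    (mul-tensor-upperʳ (λ _ → refl) z·möbius≡a d S I J J∈P)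
  WA-Z : mul d (mul d W (A S)) (Z S) ≈[ d ] Id
  WA-Z I K _ K∈P = trans (mul-assoc d W (A S) (Z S) I K)
    (trans (∑-cong-∈ (P d n) (λ J J∈P → cong₂ _*_ (W-tensor S I J) (AZ J K J∈P)))
    (trans (mul-tensor-upperʳ (λ _ → refl) möbius·subset≡id d S I K K∈P) (sym (Id-tensor S I K))))
  Z-WA : mul d (Z S) (mul d W (A S)) ≈[ d ] Id
  Z-WA I K I∈P _ = trans (sym (mul-assoc d (Z S) W (A S) I K))
    (trans (∑-cong-∈ (P d n) (λ J J∈P → cong₂ _*_ (ZW I J J∈P) (A-tensor S J K)))
    (trans (mul-tensor-lowerˡ (λ _ → refl) a·a≡id d S I K I∈P) (sym (Id-tensor S I K))))
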